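{- For each $n\ge 0$ there is a unique $C_n\in\mathbb{Z}/2[t]$ such that $(U+I)\big((r^2+r)r^{2n}\big)=(r^2+r)\,C_n(r^2)$. These polynomials satisfy: (a) $C_{n+4}=C_{n+3}+(t^4+t^3+t^2+t)C_n+t^n(t^2+t)$ for all $n\ge0$; (b) $C_0=0$, $C_1=1$, $C_2=t$, $C_3=t^2$.
   Context: $\mathbb{Z}/2[r]$ and $\mathbb{Z}/2[t]$ are polynomial rings over the field with two elements. Let $F=r(r+1)^3$ and $G=r^3(r+1)$. $\mathbb{Z}/2[r]$ is a free $\mathbb{Z}/2[G]$-module with basis $1,r,r^2,r^3$. Let $U:\mathbb{Z}/2[r]\to\mathbb{Z}/2[r]$ be the map $U\big(\sum_{i=0}^3 g_i(G)r^i\big)=\sum_{i=0}^3 g_i(F)\,U(r^i)$ (for $g_i\in\mathbb{Z}/2[T]$), where $U(1)=1$, $U(r)=r$, $U(r^2)=r^2$, $U(r^3)=r^3+r^2+r$; thus $U$ is $\mathbb{Z}/2$-linear and $U(Gf)=FU(f)$. $I$ is the identity. -}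

module Defs where

open import Data.Bool using (Bool; true; false; _xor_; if_then_else_)
open import Data.List using (List; []; _∷_)
open import Data.Nat using (ℕ; zero; suc)
open import Relation.Binary.PropositionalEquality using (_≡_)

-- Polynomials over Z/2 in one variable: coefficient lists, lowest degree first.
-- Trailing zeros are allowed; equality of polynomials is _≈_ (equal coefficients).
Poly : Set
Poly = List Bool

coeff : Poly → ℕ → Bool
coeff []      _       = false
coeff (b ∷ p) zero    = b
coeff (b ∷ p) (suc k) = coeff p k

infix 4 _≈_
_≈_ : Poly → Poly → Set
p ≈ q = ∀ k → coeff p k ≡ coeff q k

infixl 6 _+_
_+_ : Poly → Poly → Poly
[]      + q       = q
(a ∷ p) + []      = a ∷ p
(a ∷ p) + (b ∷ q) = (a xor b) ∷ (p + q)

infixl 7 _*_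
_*_ : Poly → Poly → Poly
[]      * q = []
(a ∷ p) * q = (if a then q else []) + (false ∷ (p * q))

𝟘 𝟙 X : Poly
𝟘 = []
𝟙 = true ∷ []
X = false ∷ true ∷ []   -- the variable (r, resp. t)

infixr 8 _^_
_^_ : Poly → ℕ → Poly
p ^ zero  = 𝟙
p ^ suc n = p * (p ^ n)

infixr 9 _∘_
_∘_ : Poly → Poly → Poly
[]      ∘ q = []
(a ∷ p) ∘ q = (a ∷ []) + q * (p ∘ q)

F G : Poly
F = X * (X + 𝟙) ^ 3
G = (X ^ 3) * (X + 𝟙)

-- Since Z/2[r] is free over Z/2[G] with basis 1,r,r^2,r^3, this determines U.
record IsU (U : Poly → Poly) : Set where
  field
    U-resp : ∀ {p q} → p ≈ q → U p ≈ U q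
    U-def  : ∀ g₀ g₁ g₂ g₃ →
      U (g₀ ∘ G + (g₁ ∘ G) * X + (g₂ ∘ G) * X ^ 2 + (g₃ ∘ G) * X ^ 3)
        ≈ g₀ ∘ F + (g₁ ∘ F) * X + (g₂ ∘ F) * X ^ 2
            + (g₃ ∘ F) * (X ^ 3 + X ^ 2 + X)

U+I : (Poly → Poly) → Poly → Poly
U+I U f = U f + f

-- Put f n = (X² + X) X²ⁿ. Since X⁸ = X⁶ + G², f (n + 4) = f (n + 3) + G² f n, so the
-- coordinates of f n over the 𝔽₂[G]-basis 1, X, X², X³ obey the matching recurrence, and
-- applying U (which trades G for F) gives U f (n + 4) = U f (n + 3) + F² U f n. Hence
-- (U + I) f satisfies h (n + 4) = h (n + 3) + F² h n + (F² + G²) f n. The sequence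
-- (X² + X) C n (X²) satisfies the same recurrence, and the two agree for n ≤ 3 by computation.
-- Uniqueness holds because X² + X is not a zero divisor and p ↦ p (X²) is injective.
module Submission where

open import Defs
open import Data.Bool using (Bool; true; false; _xor_; if_then_else_; T)
open import Data.Bool.Properties
  using (xor-comm; xor-assoc; xor-identityʳ; xor-same)
open import Data.List using ([]; _∷_)
open import Data.Maybe using (Maybe; just; nothing; is-just; to-witness-T)
import Data.Maybe as Maybe
open import Data.Nat using (ℕ; zero; suc)
import Data.Nat as ℕ
import Data.Nat.Properties as ℕₚ
open import Data.Product using (Σ; _×_; _,_)
open import Relation.Binary.PropositionalEquality
  using (_≡_; refl; sym; trans; cong; cong₂; module ≡-Reasoning)
open import Algebra.Bundles using (CommutativeSemigroup; CommutativeRing)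
open import Relation.Binary.Structures using (IsEquivalence)
open import Tactic.RingSolver.Core.AlmostCommutativeRing
  using (AlmostCommutativeRing; fromCommutativeRing)
open import Tactic.RingSolver using (solve-∀)

-- _≈_ unfolds to a Π-type from which Agda cannot infer its two sides; this wrapper can.
infix 4 _≋_
record _≋_ (p q : Poly) : Set where
  constructor coeffwise
  field coeff-≡ : p ≈ q
open _≋_ public

≋-refl : ∀ {p} → p ≋ p
≋-refl = coeffwise λ _ → refl

≋-sym : ∀ {p q} → p ≋ q → q ≋ p
≋-sym (coeffwise e) = coeffwise λ k → sym (e k)

≋-trans : ∀ {p q r} → p ≋ q → q ≋ r → p ≋ r
≋-trans (coeffwise e) (coeffwise f) = coeffwise λ k → trans (e k) (f k)

∷-cong : ∀ a {p q} → p ≋ q → a ∷ p ≋ a ∷ q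
∷-cong a (coeffwise e) = coeffwise λ { zero → refl ; (suc k) → e k }

≋-tail : ∀ {a b p q} → a ∷ p ≋ b ∷ q → p ≋ q
≋-tail (coeffwise e) = coeffwise λ k → e (suc k)

≋[]-tail : ∀ {a p} → a ∷ p ≋ [] → p ≋ []
≋[]-tail (coeffwise e) = coeffwise λ k → e (suc k)

false∷[]≋[] : false ∷ [] ≋ []
false∷[]≋[] = coeffwise λ { zero → refl ; (suc k) → refl }

coeff-+ : ∀ p q k → coeff (p + q) k ≡ coeff p k xor coeff q k
coeff-+ []      q       k       = refl
coeff-+ (a ∷ p) []      k       = sym (xor-identityʳ _)
coeff-+ (a ∷ p) (b ∷ q) zero    = refl
coeff-+ (a ∷ p) (b ∷ q) (suc k) = coeff-+ p q k

+-cong : ∀ {p p′ q q′} → p ≋ p′ → q ≋ q′ → p + q ≋ p′ + q′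
+-cong {p} {p′} {q} {q′} (coeffwise e) (coeffwise f) = coeffwise λ k →
  trans (coeff-+ p q k) (trans (cong₂ _xor_ (e k) (f k)) (sym (coeff-+ p′ q′ k)))

+-congˡ : ∀ p {q q′} → q ≋ q′ → p + q ≋ p + q′
+-congˡ p = +-cong (≋-refl {p})

+-congʳ : ∀ {p p′} q → p ≋ p′ → p + q ≋ p′ + q
+-congʳ q e = +-cong e (≋-refl {q})

+-comm : ∀ p q → p + q ≋ q + p
+-comm p q = coeffwise λ k →
  trans (coeff-+ p q k) (trans (xor-comm (coeff p k) _) (sym (coeff-+ q p k)))

+-assoc : ∀ p q r → (p + q) + r ≋ p + (q + r)
+-assoc p q r = coeffwise λ k → begin
  coeff ((p + q) + r) k                 ≡⟨ coeff-+ (p + q) r k ⟩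
  coeff (p + q) k xor coeff r k         ≡⟨ cong (_xor coeff r k) (coeff-+ p q k) ⟩
  (coeff p k xor coeff q k) xor coeff r k ≡⟨ xor-assoc (coeff p k) _ _ ⟩
  coeff p k xor (coeff q k xor coeff r k) ≡⟨ cong (coeff p k xor_) (coeff-+ q r k) ⟨
  coeff p k xor coeff (q + r) k         ≡⟨ coeff-+ p (q + r) k ⟨
  coeff (p + (q + r)) k                 ∎
  where open ≡-Reasoning

+-identityʳ : ∀ p → p + [] ≋ p
+-identityʳ p = coeffwise λ k → trans (coeff-+ p [] k) (xor-identityʳ (coeff p k))

+-self : ∀ p → p + p ≋ []
+-self p = coeffwise λ k → trans (coeff-+ p p k) (xor-same (coeff p k))

≋-isEquivalence : IsEquivalence _≋_
≋-isEquivalence = record { refl = ≋-refl ; sym = ≋-sym ; trans = ≋-trans }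

+-commutativeSemigroup : CommutativeSemigroup _ _
+-commutativeSemigroup = record
  { _≈_ = _≋_ ; _∙_ = _+_
  ; isCommutativeSemigroup = record
    { isSemigroup = record
      { isMagma = record { isEquivalence = ≋-isEquivalence ; ∙-cong = +-cong }
      ; assoc = +-assoc }
    ; comm = +-comm } }

open import Algebra.Properties.CommutativeSemigroup +-commutativeSemigroup
  using (interchange; x∙yz≈y∙xz)

scale : Bool → Poly → Poly
scale a q = if a then q else []

scale-xor : ∀ a b r → scale (a xor b) r ≋ scale a r + scale b r
scale-xor true  true  r = ≋-sym (+-self r)
scale-xor true  false r = ≋-sym (+-identityʳ r)
scale-xor false b     r = ≋-refl

scale-* : ∀ a q r → scale a q * r ≋ scale a (q * r)
scale-* true  q r = ≋-refl
scale-* false q r = ≋-refl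

*-zeroʳ : ∀ p → p * [] ≋ []
*-zeroʳ []          = ≋-refl
*-zeroʳ (true ∷ p)  = ≋-trans (∷-cong false (*-zeroʳ p)) false∷[]≋[]
*-zeroʳ (false ∷ p) = ≋-trans (∷-cong false (*-zeroʳ p)) false∷[]≋[]

*-identityˡ : ∀ p → 𝟙 * p ≋ p
*-identityˡ p = ≋-trans (+-congˡ p false∷[]≋[]) (+-identityʳ p)

*-identityʳ : ∀ p → p * 𝟙 ≋ p
*-identityʳ []          = ≋-refl
*-identityʳ (true ∷ p)  = ∷-cong true (*-identityʳ p)
*-identityʳ (false ∷ p) = ∷-cong false (*-identityʳ p)

*-distribʳ-+ : ∀ r p q → (p + q) * r ≋ p * r + q * r
*-distribʳ-+ r []      q       = ≋-refl
*-distribʳ-+ r (a ∷ p) []      = ≋-sym (+-identityʳ _)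
*-distribʳ-+ r (a ∷ p) (b ∷ q) = ≋-trans
  (+-cong (scale-xor a b r) (∷-cong false (*-distribʳ-+ r p q)))
  (interchange (scale a r) (scale b r) (false ∷ (p * r)) (false ∷ (q * r)))

*-assoc : ∀ p q r → (p * q) * r ≋ p * (q * r)
*-assoc []      q r = ≋-refl
*-assoc (a ∷ p) q r = ≋-trans (*-distribʳ-+ r (scale a q) (false ∷ (p * q)))
  (+-cong (scale-* a q r) (∷-cong false (*-assoc p q r)))

*-∷ʳ : ∀ p b q → p * (b ∷ q) ≋ scale b p + (false ∷ (p * q))
*-∷ʳ []      true  q = ≋-sym false∷[]≋[]
*-∷ʳ []      false q = ≋-sym false∷[]≋[]
*-∷ʳ (a ∷ p) b     q =
  ≋-trans (+-congˡ (scale a (b ∷ q)) (∷-cong false (*-∷ʳ p b q))) (swap a b)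
  where
  swap : ∀ a b → scale a (b ∷ q) + (false ∷ (scale b p + (false ∷ (p * q))))
               ≋ scale b (a ∷ p) + (false ∷ (scale a q + (false ∷ (p * q))))
  swap false false = ≋-refl
  swap true  false = ≋-refl
  swap false true  = ≋-refl
  swap true  true  = ∷-cong true (x∙yz≈y∙xz q p (false ∷ (p * q)))

*-comm : ∀ p q → p * q ≋ q * p
*-comm []      q = ≋-sym (*-zeroʳ q)
*-comm (a ∷ p) q =
  ≋-trans (+-congˡ (scale a q) (∷-cong false (*-comm p q))) (≋-sym (*-∷ʳ q a p))

*-zeroˡ-≋ : ∀ {p} q → p ≋ [] → p * q ≋ []
*-zeroˡ-≋ {[]}    q _ = ≋-refl
*-zeroˡ-≋ {a ∷ p} q e with coeff-≡ e 0
... | refl = ≋-trans (∷-cong false (*-zeroˡ-≋ q (≋[]-tail e))) false∷[]≋[]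

*-cong : ∀ {p p′ q q′} → p ≋ p′ → q ≋ q′ → p * q ≋ p′ * q′
*-cong {p} {p′} {q} {q′} e f =
  ≋-trans (congʳ q e) (≋-trans (*-comm p′ q) (≋-trans (congʳ p′ f) (*-comm q′ p′)))
  where
  congʳ : ∀ {p p′} q → p ≋ p′ → p * q ≋ p′ * q
  congʳ {[]}    {p′}     q e = ≋-sym (*-zeroˡ-≋ q (≋-sym e))
  congʳ {a ∷ p} {[]}     q e = *-zeroˡ-≋ q e
  congʳ {a ∷ p} {b ∷ p′} q e with coeff-≡ e 0
  ... | refl = +-congˡ (scale a q) (∷-cong false (congʳ q (≋-tail e)))

*-congˡ : ∀ p {q q′} → q ≋ q′ → p * q ≋ p * q′
*-congˡ p = *-cong (≋-refl {p})

*-congʳ : ∀ {p p′} q → p ≋ p′ → p * q ≋ p′ * q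
*-congʳ q e = *-cong e (≋-refl {q})

*-distribˡ-+ : ∀ p q r → p * (q + r) ≋ p * q + p * r
*-distribˡ-+ p q r = ≋-trans (*-comm p (q + r))
  (≋-trans (*-distribʳ-+ p q r) (+-cong (*-comm q p) (*-comm r p)))

𝔽₂[X] : CommutativeRing _ _
𝔽₂[X] = record
  { Carrier = Poly ; _≈_ = _≋_ ; _+_ = _+_ ; _*_ = _*_ ; -_ = λ p → p ; 0# = [] ; 1# = 𝟙
  ; isCommutativeRing = record
    { isRing = record
      { +-isAbelianGroup = record
        { isGroup = record
          { isMonoid = record
            { isSemigroup = CommutativeSemigroup.isSemigroup +-commutativeSemigroup
            ; identity = (λ _ → ≋-refl) , +-identityʳ }
          ; inverse = +-self , +-self
          ; ⁻¹-cong = λ e → e }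
        ; comm = +-comm }
      ; *-cong = *-cong
      ; *-assoc = *-assoc
      ; *-identity = *-identityˡ , *-identityʳ
      ; distrib = *-distribˡ-+ , *-distribʳ-+ }
    ; *-comm = *-comm } }

0≟_ : ∀ p → Maybe ([] ≋ p)
0≟ []          = just ≋-refl
0≟ (true ∷ p)  = nothing
0≟ (false ∷ p) = Maybe.map (λ e → ≋-trans (≋-sym false∷[]≋[]) (∷-cong false e)) (0≟ p)

𝔽₂[X]-solver : AlmostCommutativeRing _ _
𝔽₂[X]-solver = fromCommutativeRing 𝔽₂[X] 0≟_

open CommutativeRing 𝔽₂[X] using (setoid; reflexive)
open import Relation.Binary.Reasoning.Setoid setoid

≋-by-sum-zero : ∀ {p q} → p + q ≋ [] → p ≋ q
≋-by-sum-zero {p} {q} e = begin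
  p             ≈⟨ cancel p q ⟩
  (p + q) + q   ≈⟨ +-congʳ q e ⟩
  [] + q        ≡⟨⟩
  q             ∎
  where
  cancel : ∀ p q → p ≋ (p + q) + q
  cancel = solve-∀ 𝔽₂[X]-solver

≋⇒sum-zero : ∀ {p q} → p ≋ q → p + q ≋ []
≋⇒sum-zero {p} {q} e = ≋-trans (+-congʳ q e) (+-self q)

≋-by-evaluation : ∀ p q → {T (is-just (0≟ (p + q)))} → p ≋ q
≋-by-evaluation p q {t} = ≋-by-sum-zero (≋-sym (to-witness-T (0≟ (p + q)) t))

∘-+ : ∀ p p′ q → (p + p′) ∘ q ≋ p ∘ q + p′ ∘ q
∘-+ []      p′       q = ≋-refl
∘-+ (a ∷ p) []       q = ≋-sym (+-identityʳ _)
∘-+ (a ∷ p) (b ∷ p′) q = ≋-trans (+-congˡ ((a xor b) ∷ []) (*-congˡ q (∘-+ p p′ q)))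
  (regroup (a ∷ []) (b ∷ []) q (p ∘ q) (p′ ∘ q))
  where
  regroup : ∀ a b q r r′ → (a + b) + q * (r + r′) ≋ (a + q * r) + (b + q * r′)
  regroup = solve-∀ 𝔽₂[X]-solver

scale-∘ : ∀ a p q → scale a p ∘ q ≋ (a ∷ []) * (p ∘ q)
scale-∘ true  p q = ≋-sym (*-identityˡ _)
scale-∘ false p q = ≋-sym false∷[]≋[]

∘-* : ∀ p p′ q → (p * p′) ∘ q ≋ (p ∘ q) * (p′ ∘ q)
∘-* []      p′ q = ≋-refl
∘-* (a ∷ p) p′ q = begin
  (scale a p′ + (false ∷ (p * p′))) ∘ q
    ≈⟨ ∘-+ (scale a p′) (false ∷ (p * p′)) q ⟩
  scale a p′ ∘ q + ((false ∷ []) + q * ((p * p′) ∘ q))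
    ≈⟨ +-cong (scale-∘ a p′ q) (+-cong false∷[]≋[] (*-congˡ q (∘-* p p′ q))) ⟩
  (a ∷ []) * (p′ ∘ q) + ([] + q * ((p ∘ q) * (p′ ∘ q)))
    ≈⟨ regroup (a ∷ []) q (p ∘ q) (p′ ∘ q) ⟩
  ((a ∷ []) + q * (p ∘ q)) * (p′ ∘ q) ∎
  where
  regroup : ∀ a q r r′ → a * r′ + ([] + q * (r * r′)) ≋ (a + q * r) * r′
  regroup = solve-∀ 𝔽₂[X]-solver

X∘ : ∀ q → X ∘ q ≋ q
X∘ = unit
  where
  unit : ∀ q → (false ∷ []) + q * (𝟙 + q * []) ≋ q
  unit = solve-∀ 𝔽₂[X]-solver

^-cong : ∀ {p q} n → p ≋ q → p ^ n ≋ q ^ n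
^-cong zero    e = ≋-refl
^-cong (suc n) e = *-cong e (^-cong n e)

^-∘ : ∀ p n q → (p ^ n) ∘ q ≋ (p ∘ q) ^ n
^-∘ p zero    q = ≋-trans (+-congˡ 𝟙 (*-zeroʳ q)) (+-identityʳ 𝟙)
^-∘ p (suc n) q = ≋-trans (∘-* p (p ^ n) q) (*-congˡ (p ∘ q) (^-∘ p n q))

^-+ : ∀ p m n → p ^ (m ℕ.+ n) ≋ p ^ m * p ^ n
^-+ p zero    n = ≋-sym (*-identityˡ _)
^-+ p (suc m) n = ≋-trans (*-congˡ p (^-+ p m n)) (≋-sym (*-assoc p (p ^ m) (p ^ n)))

^-* : ∀ p m n → p ^ (m ℕ.* n) ≋ (p ^ m) ^ n
^-* p m zero    = reflexive (cong (p ^_) (ℕₚ.*-zeroʳ m))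
^-* p m (suc n) = begin
  p ^ (m ℕ.* suc n)       ≡⟨ cong (p ^_) (ℕₚ.*-suc m n) ⟩
  p ^ (m ℕ.+ m ℕ.* n)     ≈⟨ ^-+ p m (m ℕ.* n) ⟩
  p ^ m * p ^ (m ℕ.* n)   ≈⟨ *-congˡ (p ^ m) (^-* p m n) ⟩
  p ^ m * (p ^ m) ^ n     ∎

X² : Poly
X² = X ^ 2

X*-≋ : ∀ p → X * p ≋ false ∷ p
X*-≋ p = ∷-cong false (*-identityˡ p)

X-regular : ∀ {z} → X * z ≋ [] → z ≋ []
X-regular {z} e = ≋[]-tail (≋-trans (≋-sym (X*-≋ z)) e)

X+𝟙-regular : ∀ {z} → (X + 𝟙) * z ≋ [] → z ≋ []
X+𝟙-regular {z} e = coeffwise vanish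
  where
  shifted : z + (false ∷ z) ≋ []
  shifted = ≋-trans (+-congˡ z (∷-cong false (≋-sym (*-identityˡ z)))) e
  vanish : ∀ k → coeff z k ≡ false
  vanish zero    = trans (sym (xor-identityʳ _))
    (trans (sym (coeff-+ z (false ∷ z) 0)) (coeff-≡ shifted 0))
  vanish (suc k) = trans (sym (xor-identityʳ _))
    (trans (cong (coeff z (suc k) xor_) (sym (vanish k)))
      (trans (sym (coeff-+ z (false ∷ z) (suc k))) (coeff-≡ shifted (suc k))))

X²+X-regular : ∀ {z} → (X² + X) * z ≋ [] → z ≋ []
X²+X-regular {z} e =
  X+𝟙-regular (X-regular (≋-trans (≋-sym (*-assoc X (X + 𝟙) z)) (≋-trans (*-congʳ z factor) e)))
  where
  factor : X * (X + 𝟙) ≋ X² + X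
  factor = ≋-by-evaluation _ _

X²*-≋ : ∀ p → X² * p ≋ false ∷ false ∷ p
X²*-≋ p = ≋-trans (*-assoc X (X ^ 1) p) (≋-trans (X*-≋ (X ^ 1 * p)) (∷-cong false
  (≋-trans (*-assoc X 𝟙 p) (≋-trans (X*-≋ (𝟙 * p)) (∷-cong false (*-identityˡ p))))))

∘X²-regular : ∀ {z} → z ∘ X² ≋ [] → z ≋ []
∘X²-regular {[]}    e = ≋-refl
∘X²-regular {a ∷ z} e = head-vanishes a (≋-trans (≋-sym (+-congˡ (a ∷ []) (X²*-≋ (z ∘ X²)))) e)
  where
  head-vanishes : ∀ a → (a ∷ []) + (false ∷ false ∷ (z ∘ X²)) ≋ [] → a ∷ z ≋ []
  head-vanishes false e = ≋-trans (∷-cong false (∘X²-regular (≋[]-tail (≋[]-tail e)))) false∷[]≋[]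
  head-vanishes true  e with coeff-≡ e 0
  ... | ()

∘X²-cancel : ∀ {d d′} → (X² + X) * (d ∘ X²) ≋ (X² + X) * (d′ ∘ X²) → d ≋ d′
∘X²-cancel {d} {d′} e = ≋-by-sum-zero (∘X²-regular (X²+X-regular (begin
  (X² + X) * ((d + d′) ∘ X²)
    ≈⟨ *-congˡ (X² + X) (∘-+ d d′ (X²)) ⟩
  (X² + X) * (d ∘ X² + d′ ∘ X²)
    ≈⟨ *-distribˡ-+ (X² + X) (d ∘ X²) (d′ ∘ X²) ⟩
  (X² + X) * (d ∘ X²) + (X² + X) * (d′ ∘ X²)
    ≈⟨ ≋⇒sum-zero e ⟩
  [] ∎)))

agree-by-recurrence : ∀ (a b : ℕ → Poly) (k : Poly) (e : ℕ → Poly) →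
  (∀ n → a (4 ℕ.+ n) ≋ a (3 ℕ.+ n) + k * a n + e n) →
  (∀ n → b (4 ℕ.+ n) ≋ b (3 ℕ.+ n) + k * b n + e n) →
  a 0 ≋ b 0 → a 1 ≋ b 1 → a 2 ≋ b 2 → a 3 ≋ b 3 → ∀ n → a n ≋ b n
agree-by-recurrence a b k e rec-a rec-b a₀ a₁ a₂ a₃ = agree
  where
  agree : ∀ n → a n ≋ b n
  agree 0 = a₀
  agree 1 = a₁
  agree 2 = a₂
  agree 3 = a₃
  agree (suc (suc (suc (suc n)))) = ≋-trans (rec-a n) (≋-trans
    (+-congʳ (e n) (+-cong (agree (suc (suc (suc n)))) (*-congˡ k (agree n)))) (≋-sym (rec-b n)))

record Coords : Set where
  constructor coords
  field c₀ c₁ c₂ c₃ : Poly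
open Coords

expand : Poly → Poly → Coords → Poly
expand q b₃ g = c₀ g ∘ q + (c₁ g ∘ q) * X + (c₂ g ∘ q) * X ^ 2 + (c₃ g ∘ q) * b₃

infixl 6 _+X²*_
_+X²*_ : Coords → Coords → Coords
u +X²* w = coords (c₀ u + X² * c₀ w) (c₁ u + X² * c₁ w) (c₂ u + X² * c₂ w) (c₃ u + X² * c₃ w)

∘-+X²* : ∀ a b q → (a + X² * b) ∘ q ≋ a ∘ q + q ^ 2 * (b ∘ q)
∘-+X²* a b q = ≋-trans (∘-+ a (X² * b) q) (+-congˡ (a ∘ q)
  (≋-trans (∘-* X² b q) (*-congʳ (b ∘ q) (≋-trans (^-∘ X 2 q) (^-cong 2 (X∘ q))))))

expand-+X²* : ∀ q b₃ u w → expand q b₃ (u +X²* w) ≋ expand q b₃ u + q ^ 2 * expand q b₃ w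
expand-+X²* q b₃ u w = ≋-trans
  (+-cong (+-cong (+-cong (step c₀) (*-congʳ X (step c₁))) (*-congʳ (X ^ 2) (step c₂)))
          (*-congʳ b₃ (step c₃)))
  (regroup (c₀ u ∘ q) (c₁ u ∘ q) (c₂ u ∘ q) (c₃ u ∘ q) (c₀ w ∘ q) (c₁ w ∘ q) (c₂ w ∘ q) (c₃ w ∘ q)
           (q ^ 2) X (X ^ 2) b₃)
  where
  step : ∀ c → (c u + X² * c w) ∘ q ≋ c u ∘ q + q ^ 2 * (c w ∘ q)
  step c = ∘-+X²* (c u) (c w) q
  regroup : ∀ a₀ a₁ a₂ a₃ b₀ b₁ b₂ b₃ k y₁ y₂ y₃ →
    (a₀ + k * b₀) + (a₁ + k * b₁) * y₁ + (a₂ + k * b₂) * y₂ + (a₃ + k * b₃) * y₃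
      ≋ (a₀ + a₁ * y₁ + a₂ * y₂ + a₃ * y₃) + k * (b₀ + b₁ * y₁ + b₂ * y₂ + b₃ * y₃)
  regroup = solve-∀ 𝔽₂[X]-solver

f : ℕ → Poly
f n = (X² + X) * X ^ (2 ℕ.* n)

G-coords : ℕ → Coords
G-coords 0 = coords [] 𝟙 𝟙 []
G-coords 1 = coords X [] [] []
G-coords 2 = coords [] [] X []
G-coords 3 = coords X² [] [] X
G-coords (suc (suc (suc (suc n)))) = G-coords (suc (suc (suc n))) +X²* G-coords n

C : ℕ → Poly
C 0 = 𝟘
C 1 = 𝟙
C 2 = X
C 3 = X ^ 2
C (suc (suc (suc (suc n)))) =
  C (suc (suc (suc n))) + (X ^ 4 + X ^ 3 + X ^ 2 + X) * C n + X ^ n * (X ^ 2 + X)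

C-recurrence : ∀ n → C (n ℕ.+ 4)
  ≡ C (n ℕ.+ 3) + (X ^ 4 + X ^ 3 + X ^ 2 + X) * C n + X ^ n * (X ^ 2 + X)
C-recurrence n rewrite ℕₚ.+-comm n 4 | ℕₚ.+-comm n 3 = refl

X^2n≋X²^n : ∀ n → X ^ (2 ℕ.* n) ≋ X² ^ n
X^2n≋X²^n = ^-* X 2

f-recurrence : ∀ n → f (4 ℕ.+ n) ≋ f (3 ℕ.+ n) + G ^ 2 * f n
f-recurrence n = begin
  P * X ^ (2 ℕ.* (4 ℕ.+ n))          ≈⟨ *-congˡ P (^-* X 2 (4 ℕ.+ n)) ⟩
  P * X² ^ (4 ℕ.+ n)                 ≈⟨ *-congˡ P (^-+ X² 4 n) ⟩
  P * (X² ^ 4 * X² ^ n)              ≈⟨ *-congˡ P (*-congʳ (X² ^ n) X⁸≋X⁶+G²) ⟩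
  P * ((X² ^ 3 + G ^ 2) * X² ^ n)    ≈⟨ distribute P (X² ^ 3) (G ^ 2) (X² ^ n) ⟩
  P * (X² ^ 3 * X² ^ n) + G ^ 2 * (P * X² ^ n)
    ≈⟨ +-cong (*-congˡ P (≋-sym (^-+ X² 3 n))) (*-congˡ (G ^ 2) (*-congˡ P (≋-sym (X^2n≋X²^n n)))) ⟩
  P * X² ^ (3 ℕ.+ n) + G ^ 2 * f n
    ≈⟨ +-congʳ (G ^ 2 * f n) (*-congˡ P (≋-sym (X^2n≋X²^n (3 ℕ.+ n)))) ⟩
  f (3 ℕ.+ n) + G ^ 2 * f n          ∎
  where
  P : Poly
  P = X² + X
  X⁸≋X⁶+G² : X² ^ 4 ≋ X² ^ 3 + G ^ 2
  X⁸≋X⁶+G² = ≋-by-evaluation _ _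
  distribute : ∀ p a b t → p * ((a + b) * t) ≋ p * (a * t) + b * (p * t)
  distribute = solve-∀ 𝔽₂[X]-solver

f≋expand-G : ∀ n → f n ≋ expand G (X ^ 3) (G-coords n)
f≋expand-G = agree-by-recurrence f (λ n → expand G (X ^ 3) (G-coords n)) (G ^ 2) (λ _ → [])
  (λ n → ≋-trans (f-recurrence n) (≋-sym (+-identityʳ _)))
  (λ n → ≋-trans (expand-+X²* G (X ^ 3) (G-coords (3 ℕ.+ n)) (G-coords n)) (≋-sym (+-identityʳ _)))
  (≋-by-evaluation _ _) (≋-by-evaluation _ _) (≋-by-evaluation _ _) (≋-by-evaluation _ _)

X^n∘X² : ∀ n → (X ^ n) ∘ X² ≋ X ^ (2 ℕ.* n)
X^n∘X² n = ≋-trans (^-∘ X n X²) (≋-trans (^-cong n (X∘ X²)) (≋-sym (X^2n≋X²^n n)))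

P*C∘X²-recurrence : ∀ n → (X² + X) * (C (4 ℕ.+ n) ∘ X²)
  ≋ (X² + X) * (C (3 ℕ.+ n) ∘ X²) + F ^ 2 * ((X² + X) * (C n ∘ X²)) + (F ^ 2 + G ^ 2) * f n
P*C∘X²-recurrence n = begin
  P * ((C₃ + Q * C₀ + X ^ n * P) ∘ X²)
    ≈⟨ *-congˡ P (≋-trans (∘-+ (C₃ + Q * C₀) (X ^ n * P) X²)
                          (+-congʳ _ (∘-+ C₃ (Q * C₀) X²))) ⟩
  P * (C₃ ∘ X² + (Q * C₀) ∘ X² + (X ^ n * P) ∘ X²)
    ≈⟨ *-congˡ P (+-cong (+-congˡ (C₃ ∘ X²) (≋-trans (∘-* Q C₀ X²) (*-congʳ (C₀ ∘ X²) Q∘X²≋F²)))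
                         (≋-trans (∘-* (X ^ n) P X²) (*-cong (X^n∘X² n) P∘X²≋F²+G²))) ⟩
  P * (C₃ ∘ X² + F ^ 2 * (C₀ ∘ X²) + X ^ (2 ℕ.* n) * (F ^ 2 + G ^ 2))
    ≈⟨ regroup P (C₃ ∘ X²) (C₀ ∘ X²) (F ^ 2) (F ^ 2 + G ^ 2) (X ^ (2 ℕ.* n)) ⟩
  P * (C₃ ∘ X²) + F ^ 2 * (P * (C₀ ∘ X²)) + (F ^ 2 + G ^ 2) * (P * X ^ (2 ℕ.* n)) ∎
  where
  P Q C₃ C₀ : Poly
  P = X² + X
  Q = X ^ 4 + X ^ 3 + X ^ 2 + X
  C₃ = C (3 ℕ.+ n)
  C₀ = C n
  -- Q = F and X² + X = F + G, and p ∘ X² = p ^ 2 in characteristic 2.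
  Q∘X²≋F² : Q ∘ X² ≋ F ^ 2
  Q∘X²≋F² = ≋-by-evaluation _ _
  P∘X²≋F²+G² : P ∘ X² ≋ F ^ 2 + G ^ 2
  P∘X²≋F²+G² = ≋-by-evaluation _ _
  regroup : ∀ p c₃ c₀ k l y → p * (c₃ + k * c₀ + y * l) ≋ p * c₃ + k * (p * c₀) + l * (p * y)
  regroup = solve-∀ 𝔽₂[X]-solver

expand-F+f≋P*C∘X² : ∀ n → expand F (X ^ 3 + X ^ 2 + X) (G-coords n) + f n ≋ (X² + X) * (C n ∘ X²)
expand-F+f≋P*C∘X² = agree-by-recurrence h (λ n → (X² + X) * (C n ∘ X²))
  (F ^ 2) (λ n → (F ^ 2 + G ^ 2) * f n) h-recurrence P*C∘X²-recurrence
  (≋-by-evaluation _ _) (≋-by-evaluation _ _) (≋-by-evaluation _ _) (≋-by-evaluation _ _)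
  where
  E : ℕ → Poly
  E n = expand F (X ^ 3 + X ^ 2 + X) (G-coords n)
  h : ℕ → Poly
  h n = E n + f n
  h-recurrence : ∀ n → h (4 ℕ.+ n) ≋ h (3 ℕ.+ n) + F ^ 2 * h n + (F ^ 2 + G ^ 2) * f n
  h-recurrence n = ≋-trans
    (+-cong (expand-+X²* F (X ^ 3 + X ^ 2 + X) (G-coords (3 ℕ.+ n)) (G-coords n)) (f-recurrence n))
    (regroup (E (3 ℕ.+ n)) (E n) (f (3 ℕ.+ n)) (f n) (F ^ 2) (G ^ 2))
    where
    regroup : ∀ e₃ e₀ f₃ f₀ k l →
      (e₃ + k * e₀) + (f₃ + l * f₀) ≋ (e₃ + f₃) + k * (e₀ + f₀) + (k + l) * f₀
    regroup = solve-∀ 𝔽₂[X]-solver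

theorem1p8 : (U : Poly → Poly) → IsU U →
    Σ (ℕ → Poly) λ C →
      ((n : ℕ) → U+I U ((X ^ 2 + X) * X ^ (2 Data.Nat.* n)) ≈ (X ^ 2 + X) * (C n ∘ (X ^ 2)))
      × ((n : ℕ) (D : Poly) →
           U+I U ((X ^ 2 + X) * X ^ (2 Data.Nat.* n)) ≈ (X ^ 2 + X) * (D ∘ (X ^ 2)) → D ≈ C n)
      × ((n : ℕ) → C (n Data.Nat.+ 4)
           ≈ C (n Data.Nat.+ 3) + (X ^ 4 + X ^ 3 + X ^ 2 + X) * C n + X ^ n * (X ^ 2 + X))
      × (C 0 ≈ 𝟘) × (C 1 ≈ 𝟙) × (C 2 ≈ X) × (C 3 ≈ X ^ 2)
theorem1p8 U isU = C , (λ n → coeff-≡ (image n)) , uniqueness , recurrence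
                 , (λ _ → refl) , (λ _ → refl) , (λ _ → refl) , (λ _ → refl)
  where
  open IsU isU
  U[f] : ∀ n → U (f n) ≋ expand F (X ^ 3 + X ^ 2 + X) (G-coords n)
  U[f] n = coeffwise λ k →
    trans (U-resp {f n} (coeff-≡ (f≋expand-G n)) k) (U-def (c₀ g) (c₁ g) (c₂ g) (c₃ g) k)
    where
    g : Coords
    g = G-coords n
  image : ∀ n → U+I U (f n) ≋ (X² + X) * (C n ∘ X²)
  image n = ≋-trans (+-congʳ (f n) (U[f] n)) (expand-F+f≋P*C∘X² n)
  uniqueness : ∀ n D → U+I U (f n) ≈ (X² + X) * (D ∘ X²) → D ≈ C n
  uniqueness n D e = coeff-≡ (∘X²-cancel {D} {C n} (≋-trans (≋-sym (coeffwise e)) (image n)))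
  recurrence : ∀ n → C (n ℕ.+ 4)
    ≈ C (n ℕ.+ 3) + (X ^ 4 + X ^ 3 + X ^ 2 + X) * C n + X ^ n * (X ^ 2 + X)
  recurrence n k = cong (λ p → coeff p k) (C-recurrence n)
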